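{- Let $G$ be a finite simple connected graph with no induced $P_5$ and no induced $K_1+(K_1\cup K_3)$. Suppose $G$ has an induced 5-cycle $C$ and has no clique cut set. Then $G[N^3(C)]$ is $K_3$-free, and $N^2(C)$ can be partitioned into two sets $A$ and $B$ such that both $G[A]$ and $G[B]$ are $K_3$-free.
   Context: $K_1+(K_1\cup K_3)$ is the join of a single vertex with the disjoint union of a vertex and a triangle. For $X\subseteq V(G)$, $N^i(X)$ is the set of vertices not in $X$ at distance exactly $i$ from $X$. A clique cut set is a clique whose removal disconnects $G$. -}

module Defs where

open import Data.Nat using (ℕ; zero; suc; _<_; _≤_)
open import Data.Fin using (Fin; zero; suc)
open import Data.Bool using (Bool; true; false)
open import Data.Product using (Σ; ∃; _×_; _,_)
open import Data.Unit using (⊤)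
open import Data.Empty using (⊥)
open import Relation.Nullary using (¬_; Dec)
open import Relation.Binary.PropositionalEquality using (_≡_)
open import Function.Definitions using (Injective)
open import Function.Bundles using (_⇔_)

record Graph (n : ℕ) : Set₁ where
  field
    Adj     : Fin n → Fin n → Set
    Adj-dec : ∀ u v → Dec (Adj u v)
    Adj-sym : ∀ {u v} → Adj u v → Adj v u
    Adj-irr : ∀ {u} → ¬ Adj u u
open Graph public

module _ {n : ℕ} (G : Graph n) where

  data WalkIn (P : Fin n → Set) : Fin n → Fin n → ℕ → Set where
    here : ∀ {u} → P u → WalkIn P u u zero
    step : ∀ {u w v k} → P u → Adj G u w → WalkIn P w v k → WalkIn P u v (suc k)

  Connected : Set
  Connected = ∀ u v → ∃ λ k → WalkIn (λ _ → ⊤) u v k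

  InducedCopy : {k : ℕ} → (Fin k → Fin k → Bool) → (Fin k → Fin n) → Set
  InducedCopy H f = Injective _≡_ _≡_ f × (∀ i j → Adj G (f i) (f j) ⇔ (H i j ≡ true))

  HasInduced : {k : ℕ} → (Fin k → Fin k → Bool) → Set
  HasInduced H = ∃ λ f → InducedCopy H f

  IsClique : (Fin n → Set) → Set
  IsClique S = ∀ u v → S u → S v → ¬ (u ≡ v) → Adj G u v

  IsCliqueCutSet : (Fin n → Set) → Set
  IsCliqueCutSet S = IsClique S ×
    (∃ λ u → ∃ λ v → ¬ S u × ¬ S v × (∀ k → ¬ WalkIn (λ w → ¬ S w) u v k))

  WithinDist : (Fin n → Set) → ℕ → Fin n → Set
  WithinDist X d v = ∃ λ u → ∃ λ k → X u × k ≤ d × WalkIn (λ _ → ⊤) u v k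

  N^ : ℕ → (Fin n → Set) → Fin n → Set
  N^ i X v = ¬ X v × WithinDist X i v × (∀ d → d < i → ¬ WithinDist X d v)

  K3Free : (Fin n → Set) → Set
  K3Free X = ∀ a b c → X a → X b → X c → Adj G a b → Adj G b c → Adj G a c → ⊥

P5 : Fin 5 → Fin 5 → Bool
P5 zero (suc zero) = true
P5 (suc zero) zero = true
P5 (suc zero) (suc (suc zero)) = true
P5 (suc (suc zero)) (suc zero) = true
P5 (suc (suc zero)) (suc (suc (suc zero))) = true
P5 (suc (suc (suc zero))) (suc (suc zero)) = true
P5 (suc (suc (suc zero))) (suc (suc (suc (suc zero)))) = true
P5 (suc (suc (suc (suc zero)))) (suc (suc (suc zero))) = true
P5 _ _ = false

C5 : Fin 5 → Fin 5 → Bool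
C5 zero (suc (suc (suc (suc zero)))) = true
C5 (suc (suc (suc (suc zero)))) zero = true
C5 i j = P5 i j

-- K1 + (K1 ∪ K3): vertex 0 adjacent to all of 1,2,3,4; 1 isolated otherwise; {2,3,4} a triangle
K1+K1∪K3 : Fin 5 → Fin 5 → Bool
K1+K1∪K3 zero zero = false
K1+K1∪K3 zero _ = true
K1+K1∪K3 _ zero = true
K1+K1∪K3 (suc zero) _ = false
K1+K1∪K3 _ (suc zero) = false
K1+K1∪K3 (suc (suc zero)) (suc (suc zero)) = false
K1+K1∪K3 (suc (suc (suc zero))) (suc (suc (suc zero))) = false
K1+K1∪K3 (suc (suc (suc (suc zero)))) (suc (suc (suc (suc zero)))) = false
K1+K1∪K3 _ _ = true

-- For any vertex set X, a triangle abt in N³(X) reached by a walk u–y–w–a from X forces w to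
-- see the whole triangle (otherwise u–y–w–a–b or u–y–w–a–t is an induced P5), and then w, y, a,
-- b, t induce K1+(K1∪K3).
-- For N²(C), a neighbour of a triangle of N²(C) which also sees C sees all of C: walking round
-- the cycle, a first miss would give an induced P5. Among the vertices complete to C pick m with
-- the most neighbours anticomplete to C, and split N²(C) into N(m) and the rest. A triangle in
-- N(m) forms K1+(K1∪K3) with m and a cycle vertex; a triangle outside N(m) has a complete
-- neighbour y whose neighbours anticomplete to C strictly contain those of m, contradicting the
-- choice of m.
module Submission where

open import Defs
open import Data.Nat using (ℕ; zero; suc; _≤_; _<_; s≤s; z≤n)
open import Data.Nat.Properties using (≤-refl; <⇒≱; m≤n⇒m<n∨m≡n)
open import Data.Fin using (Fin; zero; suc; _≟_)
import Data.Fin as Fin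
open import Data.Fin.Properties using (all?; any?; <-cmp)
open import Data.Fin.Subset using (Subset; ∣_∣; _⊂_)
import Data.Fin.Subset as Subset
open import Data.Fin.Subset.Properties using (p⊂q⇒∣p∣<∣q∣)
open import Data.Bool using (Bool; true; false)
import Data.Bool.Properties as Bool
open import Data.List using (List; []; _∷_; _++_; map; allFin; filter)
open import Data.List.Extrema.Nat using (argmax; argmax-all; f[xs]≤f[argmax])
open import Data.List.Membership.Propositional using (_∈_)
open import Data.List.Membership.Propositional.Properties
  using (∈-map⁺; ∈-++⁺ˡ; ∈-++⁺ʳ; ∈-allFin; ∈-filter⁺; ∈-filter⁻)
open import Data.List.Relation.Unary.All as All using (All; []; _∷_)
open import Data.Vec using ([]; _∷_; lookup; tabulate)
open import Data.Vec.Properties using (lookup∘tabulate; []=⇒lookup; lookup⇒[]=)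
open import Data.Product using (∃; _×_; _,_; proj₁; proj₂)
open import Data.Sum using (inj₁; inj₂)
open import Data.Unit using (⊤; tt)
open import Data.Empty using (⊥; ⊥-elim)
open import Function using (_∘_)
open import Function.Bundles using (_⇔_; mk⇔; Equivalence)
open import Level using (0ℓ)
open import Relation.Binary.Definitions using (tri<; tri≈; tri>)
open import Relation.Binary.PropositionalEquality using (_≡_; _≢_; refl; sym; trans; subst)
open import Relation.Nullary using (¬_; Dec; yes; no; ¬?; does; proof)
open import Relation.Nullary.Decidable using (_×-dec_; _→-dec_; toWitness; dec-true)
open import Relation.Nullary.Reflects using (Reflects; ofʸ; ofⁿ; invert; det)
open import Relation.Unary using (Pred; Decidable)

reflects-true : ∀ {A : Set} {b} → Reflects A b → b ≡ true → A
reflects-true r refl = invert r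

reflects-false : ∀ {A : Set} {b} → Reflects A b → b ≡ false → ¬ A
reflects-false r refl = invert r

reflects⇒⇔ : ∀ {A : Set} {b} → Reflects A b → A ⇔ (b ≡ true)
reflects⇒⇔ r = mk⇔ (λ a → det r (ofʸ a)) (reflects-true r)

upperPairs : ∀ k → List (Fin k × Fin k)
upperPairs zero = []
upperPairs (suc k) =
  map (λ j → zero , suc j) (allFin k) ++ map (λ (i , j) → suc i , suc j) (upperPairs k)

∈-upperPairs : ∀ {k} {i j : Fin k} → i Fin.< j → (i , j) ∈ upperPairs k
∈-upperPairs {i = zero} {suc j} _ = ∈-++⁺ˡ (∈-map⁺ _ (∈-allFin j))
∈-upperPairs {suc k} {suc i} {suc j} (s≤s i<j) =
  ∈-++⁺ʳ (map _ (allFin k)) (∈-map⁺ _ (∈-upperPairs i<j))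

-- The last component (distinct rows) is what makes every copy of the pattern injective.
SimplePattern : ∀ {k} → (Fin k → Fin k → Bool) → Set
SimplePattern H = (∀ i j → H i j ≡ H j i) × (∀ i → H i i ≡ false)
                × (∀ i j → i ≢ j → ∃ λ l → H i l ≢ H j l)

simplePattern? : ∀ {k} (H : Fin k → Fin k → Bool) → Dec (SimplePattern H)
simplePattern? H =
  all? (λ i → all? λ j → H i j Bool.≟ H j i)
  ×-dec all? (λ i → H i i Bool.≟ false)
  ×-dec all? (λ i → all? λ j → ¬? (i ≟ j) →-dec any? λ l → ¬? (H i l Bool.≟ H j l))

simple-P5 : SimplePattern P5
simple-P5 = toWitness {a? = simplePattern? P5} _

simple-K1+K1∪K3 : SimplePattern K1+K1∪K3
simple-K1+K1∪K3 = toWitness {a? = simplePattern? K1+K1∪K3} _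

next : Fin 5 → Fin 5
next zero = suc zero
next (suc zero) = suc (suc zero)
next (suc (suc zero)) = suc (suc (suc zero))
next (suc (suc (suc zero))) = suc (suc (suc (suc zero)))
next (suc (suc (suc (suc zero)))) = zero

around-cycle : ∀ {P : Fin 5 → Set} → (∀ i → P i → P (next i)) → ∀ {j} → P j → ∀ i → P i
around-cycle {P} P-next {j} Pj i = from-zero i (to-zero j Pj)
  where
  to-zero : ∀ j → P j → P zero
  to-zero zero = λ p → p
  to-zero (suc zero) = P-next _ ∘ P-next _ ∘ P-next _ ∘ P-next _
  to-zero (suc (suc zero)) = P-next _ ∘ P-next _ ∘ P-next _
  to-zero (suc (suc (suc zero))) = P-next _ ∘ P-next _
  to-zero (suc (suc (suc (suc zero)))) = P-next _
  from-zero : ∀ i → P zero → P i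
  from-zero zero = λ p → p
  from-zero (suc zero) = P-next _
  from-zero (suc (suc zero)) = P-next _ ∘ P-next _
  from-zero (suc (suc (suc zero))) = P-next _ ∘ P-next _ ∘ P-next _
  from-zero (suc (suc (suc (suc zero)))) = P-next _ ∘ P-next _ ∘ P-next _ ∘ P-next _

toSubset : ∀ {n} {P : Pred (Fin n) 0ℓ} → Decidable P → Subset n
toSubset P? = tabulate (does ∘ P?)

module _ {n} {P : Pred (Fin n) 0ℓ} (P? : Decidable P) where

  ∈-toSubset⁺ : ∀ {v} → P v → v Subset.∈ toSubset P?
  ∈-toSubset⁺ {v} p = lookup⇒[]= v _ (trans (lookup∘tabulate _ v) (dec-true (P? v) p))

  ∈-toSubset⁻ : ∀ {v} → v Subset.∈ toSubset P? → P v
  ∈-toSubset⁻ {v} v∈ = reflects-true (proof (P? v)) (trans (sym (lookup∘tabulate _ v)) ([]=⇒lookup v∈))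

  ∃-maximiser : (f : Fin n → ℕ) → ∀ {i} → P i → ∃ λ m → P m × (∀ j → P j → f j ≤ f m)
  ∃-maximiser f {i} Pi =
    argmax f i candidates ,
    argmax-all f {xs = candidates} Pi (All.tabulate (proj₂ ∘ ∈-filter⁻ P? {xs = allFin n})) ,
    λ j Pj → All.lookup (f[xs]≤f[argmax] i candidates) (∈-filter⁺ P? (∈-allFin j) Pj)
    where
    candidates : List (Fin n)
    candidates = filter P? (allFin n)

⊂-toSubset : ∀ {n} {P Q : Pred (Fin n) 0ℓ} (P? : Decidable P) (Q? : Decidable Q)
  → (∀ {v} → P v → Q v) → ∀ {x} → Q x → ¬ P x → toSubset P? ⊂ toSubset Q?
⊂-toSubset P? Q? P⊆Q Qx ¬Px =
  (∈-toSubset⁺ Q? ∘ P⊆Q ∘ ∈-toSubset⁻ P?) , _ , ∈-toSubset⁺ Q? Qx , ¬Px ∘ ∈-toSubset⁻ P?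

module _ {n : ℕ} (G : Graph n) where

  ¬Adj-sym : ∀ {u v} → ¬ Adj G u v → ¬ Adj G v u
  ¬Adj-sym ¬uv = ¬uv ∘ Adj-sym G

  reflects-sym : ∀ {u v b} → Reflects (Adj G u v) b → Reflects (Adj G v u) b
  reflects-sym (ofʸ uv) = ofʸ (Adj-sym G uv)
  reflects-sym (ofⁿ ¬uv) = ofⁿ (¬Adj-sym ¬uv)

  inducedCopy : ∀ {k} {H : Fin k → Fin k → Bool} → SimplePattern H → (f : Fin k → Fin n)
    → All (λ (i , j) → Reflects (Adj G (f i) (f j)) (H i j)) (upperPairs k)
    → InducedCopy G H f
  inducedCopy {H = H} (H-sym , H-irr , H-rows) f upper = injective , λ i j → reflects⇒⇔ (reflects i j)
    where
    reflects : ∀ i j → Reflects (Adj G (f i) (f j)) (H i j)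
    reflects i j with <-cmp i j
    ... | tri< i<j _ _ = All.lookup upper (∈-upperPairs i<j)
    ... | tri≈ _ refl _ = subst (Reflects _) (sym (H-irr i)) (ofⁿ (Adj-irr G))
    ... | tri> _ _ j<i =
      subst (Reflects _) (H-sym j i) (reflects-sym (All.lookup upper (∈-upperPairs j<i)))

    injective : ∀ {i j} → f i ≡ f j → i ≡ j
    injective {i} {j} fi≡fj with i ≟ j
    ... | yes i≡j = i≡j
    ... | no i≢j with H-rows i j i≢j
    ...   | l , rows-differ = ⊥-elim (rows-differ
            (det (reflects i l) (subst (λ v → Reflects (Adj G v (f l)) (H j l)) (sym fi≡fj) (reflects j l))))

  inducedP5 : ∀ {v₀ v₁ v₂ v₃ v₄}
    → Adj G v₀ v₁ → Adj G v₁ v₂ → Adj G v₂ v₃ → Adj G v₃ v₄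
    → ¬ Adj G v₀ v₂ → ¬ Adj G v₀ v₃ → ¬ Adj G v₀ v₄ → ¬ Adj G v₁ v₃ → ¬ Adj G v₁ v₄ → ¬ Adj G v₂ v₄
    → HasInduced G P5
  inducedP5 {v₀} {v₁} {v₂} {v₃} {v₄} e₀₁ e₁₂ e₂₃ e₃₄ n₀₂ n₀₃ n₀₄ n₁₃ n₁₄ n₂₄ =
    _ , inducedCopy simple-P5 (lookup (v₀ ∷ v₁ ∷ v₂ ∷ v₃ ∷ v₄ ∷ []))
      (ofʸ e₀₁ ∷ ofⁿ n₀₂ ∷ ofⁿ n₀₃ ∷ ofⁿ n₀₄ ∷ ofʸ e₁₂ ∷ ofⁿ n₁₃ ∷ ofⁿ n₁₄ ∷ ofʸ e₂₃ ∷ ofⁿ n₂₄ ∷ ofʸ e₃₄ ∷ [])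

  Triangle : Fin n → Fin n → Fin n → Set
  Triangle a b t = Adj G a b × Adj G b t × Adj G a t

  -- v₀ is the apex, v₁ the isolated vertex and v₂ v₃ v₄ the triangle.
  inducedK1+K1∪K3 : ∀ {v₀ v₁ v₂ v₃ v₄}
    → Adj G v₀ v₁ → Adj G v₀ v₂ → Adj G v₀ v₃ → Adj G v₀ v₄ → Triangle v₂ v₃ v₄
    → ¬ Adj G v₁ v₂ → ¬ Adj G v₁ v₃ → ¬ Adj G v₁ v₄
    → HasInduced G K1+K1∪K3
  inducedK1+K1∪K3 {v₀} {v₁} {v₂} {v₃} {v₄} e₀₁ e₀₂ e₀₃ e₀₄ (e₂₃ , e₃₄ , e₂₄) n₁₂ n₁₃ n₁₄ =
    _ , inducedCopy simple-K1+K1∪K3 (lookup (v₀ ∷ v₁ ∷ v₂ ∷ v₃ ∷ v₄ ∷ []))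
      (ofʸ e₀₁ ∷ ofʸ e₀₂ ∷ ofʸ e₀₃ ∷ ofʸ e₀₄ ∷ ofⁿ n₁₂ ∷ ofⁿ n₁₃ ∷ ofⁿ n₁₄ ∷ ofʸ e₂₃ ∷ ofʸ e₂₄ ∷ ofʸ e₃₄ ∷ [])

  K3Free-mono : ∀ {X Y : Fin n → Set} → (∀ {v} → X v → Y v) → K3Free G Y → K3Free G X
  K3Free-mono X⊆Y Y-free a b t Xa Xb Xt = Y-free a b t (X⊆Y Xa) (X⊆Y Xb) (X⊆Y Xt)

  module _ {X : Fin n → Set} where

    N^-exact-walk : ∀ {i v} → N^ G i X v → ∃ λ u → X u × WalkIn G (λ _ → ⊤) u v i
    N^-exact-walk (_ , (u , k , Xu , k≤i , walk) , no-shorter) with m≤n⇒m<n∨m≡n k≤i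
    ... | inj₁ k<i = ⊥-elim (no-shorter k k<i (u , k , Xu , ≤-refl , walk))
    ... | inj₂ refl = u , Xu , walk

    N^-no-short-walk : ∀ {i d u v} → N^ G i X v → X u → WalkIn G (λ _ → ⊤) u v d → d < i → ⊥
    N^-no-short-walk (_ , _ , no-shorter) Xu walk d<i = no-shorter _ d<i (_ , _ , Xu , ≤-refl , walk)

    N^-nonadjacent : ∀ {i u v} → N^ G (suc (suc i)) X v → X u → ¬ Adj G u v
    N^-nonadjacent Nv Xu uv = N^-no-short-walk Nv Xu (step tt uv (here tt)) (s≤s (s≤s z≤n))

  module _ (P5-free : ¬ HasInduced G P5) (K-free : ¬ HasInduced G K1+K1∪K3) where

    ¬path-hanging-off-triangle : ∀ {u y w a b t} → Triangle a b t
      → Adj G u y → Adj G y w → Adj G w a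
      → ¬ Adj G u w → ¬ Adj G u a → ¬ Adj G u b → ¬ Adj G u t
      → ¬ Adj G y a → ¬ Adj G y b → ¬ Adj G y t → ⊥
    ¬path-hanging-off-triangle {u} {y} {w} {a} abt@(ab , bt , at) uy yw wa ¬uw ¬ua ¬ub ¬ut ¬ya ¬yb ¬yt =
      K-free (inducedK1+K1∪K3 (Adj-sym G yw) wa (w-sees ab ¬ub ¬yb) (w-sees at ¬ut ¬yt) abt ¬ya ¬yb ¬yt)
      where
      w-sees : ∀ {x} → Adj G a x → ¬ Adj G u x → ¬ Adj G y x → Adj G w x
      w-sees {x} ax ¬ux ¬yx with Adj-dec G w x
      ... | yes wx = wx
      ... | no ¬wx = ⊥-elim (P5-free (inducedP5 uy yw wa ax ¬uw ¬ua ¬ux ¬ya ¬yx ¬wx))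

    N³-triangle-free : (X : Fin n → Set) → K3Free G (N^ G 3 X)
    N³-triangle-free X a b t Na Nb Nt ab bt at with N^-exact-walk Na
    ... | u , Xu , step {w = y} _ uy (step _ yw (step _ wa (here _))) =
      ¬path-hanging-off-triangle (ab , bt , at) uy yw wa
        (λ uw → N^-no-short-walk Na Xu (step tt uw (step tt wa (here tt))) (s≤s (s≤s (s≤s z≤n))))
        (N^-nonadjacent Na Xu) (N^-nonadjacent Nb Xu) (N^-nonadjacent Nt Xu)
        (no-2-walk Na) (no-2-walk Nb) (no-2-walk Nt)
      where
      no-2-walk : ∀ {v} → N^ G 3 X v → ¬ Adj G y v
      no-2-walk Nv yv = N^-no-short-walk Nv Xu (step tt uy (step tt yv (here tt))) ≤-refl

  module _ (c : Fin 5 → Fin n) (c-induced : InducedCopy G C5 c) where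

    OnCycle : Fin n → Set
    OnCycle v = ∃ λ i → c i ≡ v

    Anticomplete : Fin n → Set
    Anticomplete v = ∀ i → ¬ Adj G (c i) v

    Complete : Fin n → Set
    Complete v = ∀ i → Adj G (c i) v

    anticomplete? : Decidable Anticomplete
    anticomplete? v = all? λ i → ¬? (Adj-dec G (c i) v)

    complete? : Decidable Complete
    complete? v = all? λ i → Adj-dec G (c i) v

    cycle-edge : ∀ i → Adj G (c i) (c (next i))
    cycle-edge i = Equivalence.from (proj₂ c-induced i (next i)) (C5-next i)
      where
      C5-next : ∀ i → C5 i (next i) ≡ true
      C5-next zero = refl
      C5-next (suc zero) = refl
      C5-next (suc (suc zero)) = refl
      C5-next (suc (suc (suc zero))) = refl
      C5-next (suc (suc (suc (suc zero)))) = refl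

    N²⇒anticomplete : ∀ {v} → N^ G 2 OnCycle v → Anticomplete v
    N²⇒anticomplete Nv i = N^-nonadjacent Nv (i , refl)

    FarNeighbour : Fin n → Fin n → Set
    FarNeighbour x v = Adj G x v × Anticomplete v

    farNeighbour? : ∀ x → Decidable (FarNeighbour x)
    farNeighbour? x v = Adj-dec G x v ×-dec anticomplete? v

    farNeighbours : Fin n → Subset n
    farNeighbours x = toSubset (farNeighbour? x)

    module _ (P5-free : ¬ HasInduced G P5) (K-free : ¬ HasInduced G K1+K1∪K3) where

      -- If y missed c (next i) but saw c i, then x–a–y–c i–c (next i) would be an induced P5.
      triangle-neighbour-complete : ∀ {a b t y j} → Triangle a b t
        → Anticomplete a → Anticomplete b → Anticomplete t
        → Adj G y a → Adj G (c j) y → Complete y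
      triangle-neighbour-complete {a} {b} {t} {y} (ab , bt , at) Aa Ab At ya cy =
        around-cycle sees-next cy
        where
        missed : ∃ λ x → Adj G a x × Anticomplete x × ¬ Adj G y x
        missed with Adj-dec G y b | Adj-dec G y t
        ... | no ¬yb | _ = b , ab , Ab , ¬yb
        ... | yes _ | no ¬yt = t , at , At , ¬yt
        ... | yes yb | yes yt = ⊥-elim (K-free
          (inducedK1+K1∪K3 (Adj-sym G cy) ya yb yt (ab , bt , at) (Aa _) (Ab _) (At _)))
        sees-next : ∀ i → Adj G (c i) y → Adj G (c (next i)) y
        sees-next i ciy with Adj-dec G (c (next i)) y | missed
        ... | yes ci'y | _ = ci'y
        ... | no ¬ci'y | x , ax , Ax , ¬yx = ⊥-elim (P5-free
          (inducedP5 (Adj-sym G (cycle-edge i)) ciy ya ax ¬ci'y (Aa _) (Ax _) (Aa _) (Ax _) ¬yx))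

      N²-triangle⇒complete-neighbour : ∀ {a b t}
        → N^ G 2 OnCycle a → N^ G 2 OnCycle b → N^ G 2 OnCycle t
        → Triangle a b t → ∃ λ y → Complete y × Adj G y a
      N²-triangle⇒complete-neighbour Na Nb Nt abt with N^-exact-walk Na
      ... | _ , (j , refl) , step {w = y} _ cy (step _ ya (here _)) =
        y , triangle-neighbour-complete abt (N²⇒anticomplete Na) (N²⇒anticomplete Nb) (N²⇒anticomplete Nt) ya cy ,
        ya

      N²-triangle-free : ¬ ∃ Complete → K3Free G (N^ G 2 OnCycle)
      N²-triangle-free ¬∃complete a b t Na Nb Nt ab bt at =
        ¬∃complete (_ , proj₁ (proj₂ (N²-triangle⇒complete-neighbour Na Nb Nt (ab , bt , at))))

      N²∩N-triangle-free : ∀ {m} → Complete m → K3Free G (λ v → N^ G 2 OnCycle v × Adj G m v)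
      N²∩N-triangle-free Cm a b t (Na , ma) (Nb , mb) (Nt , mt) ab bt at =
        K-free (inducedK1+K1∪K3 (Adj-sym G (Cm zero)) ma mb mt (ab , bt , at)
          (N²⇒anticomplete Na zero) (N²⇒anticomplete Nb zero) (N²⇒anticomplete Nt zero))

      N²∖N-triangle-free : ∀ {m} → Complete m
        → (∀ y → Complete y → ∣ farNeighbours y ∣ ≤ ∣ farNeighbours m ∣)
        → K3Free G (λ v → N^ G 2 OnCycle v × ¬ Adj G m v)
      N²∖N-triangle-free {m} Cm maximal a b t (Na , ¬ma) (Nb , ¬mb) (Nt , ¬mt) ab bt at
        with N²-triangle⇒complete-neighbour Na Nb Nt (ab , bt , at)
      ... | y , Cy , ya = <⇒≱ (p⊂q⇒∣p∣<∣q∣ grows) (maximal y Cy)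
        where
        Aa : Anticomplete a
        Aa = N²⇒anticomplete Na
        ¬my : ¬ Adj G m y
        ¬my my = K-free (inducedK1+K1∪K3 ya (Adj-sym G my) (Adj-sym G (Cy zero)) (Adj-sym G (Cy (suc zero)))
          (Adj-sym G (Cm zero) , cycle-edge zero , Adj-sym G (Cm (suc zero)))
          (¬Adj-sym ¬ma) (¬Adj-sym (Aa zero)) (¬Adj-sym (Aa (suc zero))))
        y-sees : ∀ {d} → Adj G m d → Anticomplete d → Adj G y d
        y-sees {d} md Ad with Adj-dec G y d | Adj-dec G d a
        ... | yes yd | _ = yd
        ... | no ¬yd | yes da = ⊥-elim (¬path-hanging-off-triangle P5-free K-free (ab , bt , at) (Cm zero) md da
          (Ad zero) (Aa zero) (N²⇒anticomplete Nb zero) (N²⇒anticomplete Nt zero) ¬ma ¬mb ¬mt)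
        ... | no ¬yd | no ¬da = ⊥-elim (P5-free (inducedP5 (Adj-sym G md) (Adj-sym G (Cm zero)) (Cy zero) ya
          (¬Adj-sym (Ad zero)) (¬Adj-sym ¬yd) ¬da ¬my ¬ma (Aa zero)))
        grows : farNeighbours m ⊂ farNeighbours y
        grows = ⊂-toSubset (farNeighbour? m) (farNeighbour? y) (λ (md , Ad) → y-sees md Ad , Ad) (ya , Aa) (¬ma ∘ proj₁)

      N²-split-triangle-free : ∃ λ (χ : Fin n → Bool) →
        K3Free G (λ v → N^ G 2 OnCycle v × χ v ≡ true) × K3Free G (λ v → N^ G 2 OnCycle v × χ v ≡ false)
      N²-split-triangle-free with any? complete?
      ... | no ¬∃complete =
        (λ _ → true) , K3Free-mono proj₁ (N²-triangle-free ¬∃complete) , K3Free-mono proj₁ (N²-triangle-free ¬∃complete)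
      ... | yes (_ , Ch) with ∃-maximiser complete? (∣_∣ ∘ farNeighbours) Ch
      ... | m , Cm , maximal =
        (does ∘ Adj-dec G m) ,
        K3Free-mono (λ (Nv , χv) → Nv , reflects-true (proof (Adj-dec G m _)) χv) (N²∩N-triangle-free Cm) ,
        K3Free-mono (λ (Nv , χv) → Nv , reflects-false (proof (Adj-dec G m _)) χv) (N²∖N-triangle-free Cm maximal)

lemma6p4 : {n : ℕ} (G : Graph n) → Connected G
    → ¬ HasInduced G P5 → ¬ HasInduced G K1+K1∪K3
    → (c : Fin 5 → Fin n) → InducedCopy G C5 c
    → (∀ (S : Fin n → Set) → ¬ IsCliqueCutSet G S)
    → K3Free G (N^ G 3 (λ v → ∃ λ i → c i ≡ v))
      × (∃ λ (χ : Fin n → Bool) →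
           K3Free G (λ v → N^ G 2 (λ w → ∃ λ i → c i ≡ w) v × χ v ≡ true)
           × K3Free G (λ v → N^ G 2 (λ w → ∃ λ i → c i ≡ w) v × χ v ≡ false))
lemma6p4 G _ P5-free K-free c c-induced _ =
  N³-triangle-free G P5-free K-free (λ v → ∃ λ i → c i ≡ v) ,
  N²-split-triangle-free G c c-induced P5-free K-free
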